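{- Let $m\ge 1$ and $k_1,\dots,k_c\in\{0,\dots,m\}$. Choose subsets $A_1,\dots,A_c\subseteq[m]$ independently with $A_d$ uniformly random of size $k_d$, and let $X_\cap=|A_1\cap\dots\cap A_c|$. Then the distribution of $X_\cap$ is a generalized hypergeometric factorial-moment distribution.
   Context: A distribution on the nonnegative integers is a generalized hypergeometric factorial-moment distribution (GHFMD) if its probability generating function $G(z)=\mathbb{E}[z^X]$ has the form ${}_pF_q\!\left(\begin{smallmatrix}a_1,\dots,a_p\\ b_1,\dots,b_q\end{smallmatrix};\lambda(z-1)\right)$ for some parameters $a_i,b_i,\lambda$, where ${}_pF_q\!\left(\begin{smallmatrix}a_1,\dots,a_p\\ b_1,\dots,b_q\end{smallmatrix};t\right)=\sum_{j\ge 0}\frac{\prod_{i}(a_i)^{(j)}}{\prod_i (b_i)^{(j)}}\frac{t^j}{j!}$ and $(a)^{(j)}=a(a+1)\cdots(a+j-1)$. -}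

module Defs where

open import Data.Nat as ℕ using (ℕ; zero; suc)
open import Data.Integer using (+_)
open import Data.Rational using (ℚ; _+_; _*_; _-_; 0ℚ; 1ℚ; _÷_; _/_; NonZero)
open import Data.Rational.Properties using (_≟_)
open import Data.Bool using (Bool; true; false)
open import Data.List using (List; []; _∷_; map; _++_; concatMap; filter; length; foldr)
open import Data.Vec using (Vec; []; _∷_; toList)
open import Data.Fin.Subset using (Subset; inside; outside; ∣_∣; ⋂)
open import Relation.Nullary using (yes; no; ¬_)
open import Relation.Binary.PropositionalEquality using (_≡_; _≢_)
open import Data.Product using (Σ; _×_; ∃-syntax)

ℕtoℚ : ℕ → ℚ
ℕtoℚ n = (+ n) / 1

_^ℚ_ : ℚ → ℕ → ℚ
x ^ℚ zero    = 1ℚ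
x ^ℚ (suc n) = x * (x ^ℚ n)

sumℚ : List ℚ → ℚ
sumℚ = foldr _+_ 0ℚ

productℚ : List ℚ → ℚ
productℚ = foldr _*_ 1ℚ

Σ≤ : ℕ → (ℕ → ℚ) → ℚ
Σ≤ zero    f = f 0
Σ≤ (suc N) f = Σ≤ N f + f (suc N)

-- division, used only with a nonzero denominator (value at 0 is irrelevant)
divℚ : ℚ → ℚ → ℚ
divℚ p q with q ≟ 0ℚ
... | yes _ = 0ℚ
... | no q≢0 = _÷_ p q {{Data.Rational.≢-nonZero q≢0}}

allSubsets : (m : ℕ) → List (Subset m)
allSubsets zero    = [] ∷ []
allSubsets (suc m) = map (outside ∷_) (allSubsets m) ++ map (inside ∷_) (allSubsets m)

subsetsOfSize : (m k : ℕ) → List (Subset m)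
subsetsOfSize m k = filter (λ A → ∣ A ∣ ℕ.≟ k) (allSubsets m)

-- all tuples (A_1,…,A_c) with |A_d| = k_d; independent uniform choice
-- of the A_d is the uniform distribution on this list
tuples : (m : ℕ) {c : ℕ} → Vec ℕ c → List (Vec (Subset m) c)
tuples m []       = [] ∷ []
tuples m (k ∷ ks) = concatMap (λ A → map (A ∷_) (tuples m ks)) (subsetsOfSize m k)

Xcap : {m c : ℕ} → Vec (Subset m) c → ℕ
Xcap As = ∣ ⋂ (toList As) ∣

pgfXcap : (m : ℕ) {c : ℕ} → Vec ℕ c → ℚ → ℚ
pgfXcap m ks z =
  divℚ (sumℚ (map (λ As → z ^ℚ Xcap As) (tuples m ks)))
       (ℕtoℚ (length (tuples m ks)))

-- Generalized hypergeometric series  pFq(a;b;t) = Σ_j u_j t^j,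
-- u_j = Π_i (a_i)^{(j)} / (Π_i (b_i)^{(j)} j!),
-- with the usual termination convention: once a term vanishes
-- (a numerator parameter hit zero), all later terms vanish, and
-- a term is only defined if its denominator is nonzero.

shiftedProd : List ℚ → ℕ → ℚ
shiftedProd xs j = productℚ (map (λ x → x + ℕtoℚ j) xs)

record IsHypCoeffs (as bs : List ℚ) (u : ℕ → ℚ) : Set where
  field
    initial : u 0 ≡ 1ℚ
    step    : ∀ j → u (suc j) * (shiftedProd bs j * ℕtoℚ (suc j))
                    ≡ u j * shiftedProd as j
    defined : ∀ j → u (suc j) ≢ 0ℚ → shiftedProd bs j ≢ 0ℚ
    stops   : ∀ j → u j ≡ 0ℚ → u (suc j) ≡ 0ℚ

-- A (finitely supported) distribution with pgf G is a GHFMD: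
-- G(z) = pFq(a_1..a_p ; b_1..b_q ; λ(z-1)) for all z, the series
-- being a terminating one (so that it is a polynomial and convergence
-- is automatic).
IsGHFMD : (ℚ → ℚ) → Set
IsGHFMD G =
  ∃[ as ] ∃[ bs ] ∃[ λ′ ] ∃[ u ] ∃[ N ]
    ( IsHypCoeffs as bs u
    × (∀ j → N ℕ.< j → u j ≡ 0ℚ)
    × (∀ z → G z ≡ Σ≤ N (λ j → u j * ((λ′ * (z - 1ℚ)) ^ℚ j))) )

module Submission where

-- Write w = z - 1.  Expanding z^{|B ∩ A_1 ∩ … ∩ A_c|}
-- = (1+w)^{|…|} by the binomial theorem and summing over all tuples, the
-- coefficient of w^j counts pairs (J, (A_d)) with J a j-subset of B lying in
-- every A_d.  By double counting (count-intersections) this is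
-- C(|B|,j) · Π_d S(m,k_d,j), where S(m,k,j) = C(m-j,k-j) is the number of
-- k-subsets of [m] containing a fixed j-set.  For B = [m], dividing by the
-- number Π_d C(m,k_d) of tuples gives the pgf  Σ_j u_j (-(z-1))^j  with
-- u_j = (-1)^j C(m,j) Π_d S(m,k_d,j) / Π_d C(m,k_d), and the ratios
-- C(m,j+1)/C(m,j) = (m-j)/(j+1), S(m,k,j+1)/S(m,k,j) = (k-j)/(m-j) show that
-- u is the coefficient sequence of ₚF_q(-k_1,…,-k_c ; -m,…,-m ; ·) with c-1
-- denominator parameters.

open import Defs
open import Data.Nat using (ℕ; _≤_)
open import Data.Vec using (Vec; lookup)
open import Data.List using (List)

-- Binomial coefficients, defined by Pascal's rule so that identities about
-- them can be proved by structural recursion, and the numbers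
-- supersets m k j of k-subsets of [m] containing a fixed j-subset.
module Binomial where
  open import Data.Nat using (zero; suc; _+_; _*_; _∸_; _<_; s≤s)
  open import Data.Nat.Properties
    using (+-comm; +-identityʳ; *-distribʳ-+; *-suc; m+n≡0⇒m≡0; m≤n⇒m≤1+n; ≰⇒>; _≤?_; +-∸-assoc)
  open import Data.Nat.Solver using (module +-*-Solver)
  open import Relation.Nullary using (yes; no)
  open import Relation.Binary.PropositionalEquality
  open +-*-Solver

  choose : ℕ → ℕ → ℕ
  choose n       zero    = 1
  choose zero    (suc k) = 0
  choose (suc n) (suc k) = choose n k + choose n (suc k)

  choose-vanishes : ∀ n k → n < k → choose n k ≡ 0
  choose-vanishes zero    (suc k) _       = refl
  choose-vanishes (suc n) (suc k) (s≤s n<k)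
    rewrite choose-vanishes n k n<k | choose-vanishes n (suc k) (m≤n⇒m≤1+n n<k) = refl

  choose-nonzero : ∀ n k → k ≤ n → choose n k ≢ 0
  choose-nonzero n       zero    _         ()
  choose-nonzero (suc n) (suc k) (s≤s k≤n) eq = choose-nonzero n k k≤n (m+n≡0⇒m≡0 (choose n k) eq)

  choose-1 : ∀ n → choose n 1 ≡ n
  choose-1 zero    = refl
  choose-1 (suc n) = cong suc (choose-1 n)

  choose-absorb : ∀ n k → choose (suc n) (suc k) * suc k ≡ choose n k * suc n
  choose-absorb zero    zero    = refl
  choose-absorb zero    (suc k) = refl
  choose-absorb (suc n) zero    rewrite choose-1 n = solve 1 (λ n → (con 2 :+ n) :* con 1 := con 1 :* (con 2 :+ n)) refl n
  choose-absorb (suc n) (suc k) = begin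
    (a + b) * (2 + k)                          ≡⟨ solve 3 (λ a b k → (a :+ b) :* (con 2 :+ k) := a :* (con 1 :+ k) :+ a :+ b :* (con 2 :+ k)) refl a b k ⟩
    a * suc k + a + b * (2 + k)                ≡⟨ cong₂ (λ x y → x + a + y) (choose-absorb n k) (choose-absorb n (suc k)) ⟩
    c * suc n + (c + d) + d * suc n            ≡⟨ solve 3 (λ c d n → c :* (con 1 :+ n) :+ (c :+ d) :+ d :* (con 1 :+ n) := (c :+ d) :* (con 2 :+ n)) refl c d n ⟩
    (c + d) * (2 + n)                          ∎
    where
    open ≡-Reasoning
    a = choose (suc n) (suc k)
    b = choose (suc n) (suc (suc k))
    c = choose n k
    d = choose n (suc k)

  choose-ratio : ∀ n j → choose n (suc j) * suc j ≡ choose n j * (n ∸ j)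
  choose-ratio zero    zero    = refl
  choose-ratio zero    (suc j) = refl
  choose-ratio (suc n) zero    rewrite choose-1 n = solve 1 (λ n → (con 1 :+ n) :* con 1 := con 1 :* (con 1 :+ n)) refl n
  choose-ratio (suc n) (suc j) = begin
    (a + b) * (2 + j)                          ≡⟨ solve 3 (λ a b j → (a :+ b) :* (con 2 :+ j) := a :* (con 1 :+ j) :+ (a :+ b :* (con 2 :+ j))) refl a b j ⟩
    a * suc j + (a + b * (2 + j))              ≡⟨ cong₂ (λ x y → x + (a + y)) (choose-ratio n j) (choose-ratio n (suc j)) ⟩
    c * (n ∸ j) + (a + a * (n ∸ suc j))        ≡⟨ cong (c * (n ∸ j) +_) (peel n j) ⟩
    c * (n ∸ j) + a * (n ∸ j)                  ≡⟨ *-distribʳ-+ (n ∸ j) c a ⟨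
    (c + a) * (n ∸ j)                          ∎
    where
    open ≡-Reasoning
    a = choose n (suc j)
    b = choose n (suc (suc j))
    c = choose n j
    -- C(n,j+1)·(1 + (n-j-1)) = C(n,j+1)·(n-j); when j ≥ n both sides vanish.
    peel : ∀ n j → choose n (suc j) + choose n (suc j) * (n ∸ suc j) ≡ choose n (suc j) * (n ∸ j)
    peel n j with suc j ≤? n
    ... | yes j<n rewrite +-∸-assoc 1 j<n = sym (*-suc (choose n (suc j)) (n ∸ suc j))
    ... | no  j≮n rewrite choose-vanishes n (suc j) (≰⇒> j≮n) = refl

  -- supersets m k j counts the k-subsets of [m] containing a fixed j-subset
  -- (it equals C(m-j, k-j)); recursion removes one point of the fixed set.
  supersets : ℕ → ℕ → ℕ → ℕ
  supersets m       k       zero    = choose m k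
  supersets zero    k       (suc j) = 0
  supersets (suc m) zero    (suc j) = 0
  supersets (suc m) (suc k) (suc j) = supersets m k j

  supersets-vanishes : ∀ m k j → k < j → supersets m k j ≡ 0
  supersets-vanishes zero    k       (suc j) _         = refl
  supersets-vanishes (suc m) zero    (suc j) _         = refl
  supersets-vanishes (suc m) (suc k) (suc j) (s≤s k<j) = supersets-vanishes m k j k<j

  -- Only the empty set is a 0-subset, whatever the ground set.
  supersets-empty : ∀ m j → supersets (suc m) 0 j ≡ supersets m 0 j
  supersets-empty m       zero    = refl
  supersets-empty zero    (suc j) = refl
  supersets-empty (suc m) (suc j) = refl

  -- Pascal's rule, splitting on whether the new point m+1 is chosen.
  supersets-pascal : ∀ m k j → j ≤ m → supersets (suc m) (suc k) j ≡ supersets m (suc k) j + supersets m k j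
  supersets-pascal m       k       zero    _         = +-comm (choose m k) (choose m (suc k))
  supersets-pascal (suc m) zero    (suc j) _         = trans (supersets-empty m j) (sym (+-identityʳ _))
  supersets-pascal (suc m) (suc k) (suc j) (s≤s j≤m) = supersets-pascal m k j j≤m

  supersets-ratio : ∀ m k j → supersets m k (suc j) * (m ∸ j) ≡ supersets m k j * (k ∸ j)
  supersets-ratio zero    zero    zero    = refl
  supersets-ratio zero    (suc k) zero    = refl
  supersets-ratio (suc m) zero    zero    = refl
  supersets-ratio (suc m) (suc k) zero    = sym (choose-absorb m k)
  supersets-ratio zero    k       (suc j) = refl
  supersets-ratio (suc m) zero    (suc j) = refl
  supersets-ratio (suc m) (suc k) (suc j) = supersets-ratio m k j

module Counting where
  open Binomial
  open import Data.Nat using (zero; suc; _+_; _*_; _≟_; _≤?_; z≤n; s≤s)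
  open import Data.Nat.Solver using (module +-*-Solver)
  open import Data.Nat.Properties using (*-distribˡ-+; *-distribʳ-+; *-zeroʳ; suc-injective; ≤-trans; ≰⇒>)
  open import Data.Nat.ListAction using (sum)
  open import Data.Nat.ListAction.Properties using (sum-++)
  open import Data.List using (List; []; _∷_; map; _++_; filter)
  open import Data.List.Properties using (filter-++; filter-≐; filter-none; map-++; map-∘; ++-identityʳ)
  open import Data.List.Relation.Unary.All using (universal)
  open import Data.Vec using ([]; _∷_)
  open import Data.Bool using (true; false)
  open import Data.Fin.Subset using (Subset; inside; outside; ∣_∣; _∩_)
  open import Data.Fin.Subset.Properties using (∣p∣≤n)
  open import Relation.Nullary using (does; yes; no)
  open import Relation.Unary using (Pred; Decidable)
  open import Relation.Binary.PropositionalEquality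
  open import Data.Product using (_,_)
  open import Function using (_∘_)
  open import Level using (0ℓ)

  filter-map : ∀ {A B : Set} {P : Pred B 0ℓ} (P? : Decidable P) (g : A → B) (xs : List A) →
               filter P? (map g xs) ≡ map g (filter (P? ∘ g) xs)
  filter-map P? g []       = refl
  filter-map P? g (x ∷ xs) with does (P? (g x))
  ... | true  = cong (g x ∷_) (filter-map P? g xs)
  ... | false = filter-map P? g xs

  subsetsOfSize-zero : ∀ m → subsetsOfSize (suc m) 0 ≡ map (outside ∷_) (subsetsOfSize m 0)
  subsetsOfSize-zero m = begin
    filter has0 (map (outside ∷_) S ++ map (inside ∷_) S)
      ≡⟨ filter-++ has0 (map (outside ∷_) S) (map (inside ∷_) S) ⟩
    filter has0 (map (outside ∷_) S) ++ filter has0 (map (inside ∷_) S)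
      ≡⟨ cong₂ _++_ (filter-map has0 (outside ∷_) S) (filter-map has0 (inside ∷_) S) ⟩
    map (outside ∷_) (subsetsOfSize m 0) ++ map (inside ∷_) (filter (λ A → suc ∣ A ∣ ≟ 0) S)
      ≡⟨ cong (λ xs → map (outside ∷_) (subsetsOfSize m 0) ++ map (inside ∷_) xs)
              (filter-none (λ A → suc ∣ A ∣ ≟ 0) (universal (λ _ ()) S)) ⟩
    map (outside ∷_) (subsetsOfSize m 0) ++ []
      ≡⟨ ++-identityʳ _ ⟩
    map (outside ∷_) (subsetsOfSize m 0) ∎
    where
    open ≡-Reasoning
    S = allSubsets m
    has0 = λ (A : Subset (suc m)) → ∣ A ∣ ≟ 0

  subsetsOfSize-suc : ∀ m k → subsetsOfSize (suc m) (suc k) ≡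
                      map (outside ∷_) (subsetsOfSize m (suc k)) ++ map (inside ∷_) (subsetsOfSize m k)
  subsetsOfSize-suc m k = begin
    filter hasK (map (outside ∷_) S ++ map (inside ∷_) S)
      ≡⟨ filter-++ hasK (map (outside ∷_) S) (map (inside ∷_) S) ⟩
    filter hasK (map (outside ∷_) S) ++ filter hasK (map (inside ∷_) S)
      ≡⟨ cong₂ _++_ (filter-map hasK (outside ∷_) S) (filter-map hasK (inside ∷_) S) ⟩
    map (outside ∷_) (subsetsOfSize m (suc k)) ++ map (inside ∷_) (filter (λ A → suc ∣ A ∣ ≟ suc k) S)
      ≡⟨ cong (λ xs → map (outside ∷_) (subsetsOfSize m (suc k)) ++ map (inside ∷_) xs)
              (filter-≐ (λ A → suc ∣ A ∣ ≟ suc k) (λ A → ∣ A ∣ ≟ k) (suc-injective , cong suc) S) ⟩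
    map (outside ∷_) (subsetsOfSize m (suc k)) ++ map (inside ∷_) (subsetsOfSize m k) ∎
    where
    open ≡-Reasoning
    S = allSubsets m
    hasK = λ (A : Subset (suc m)) → ∣ A ∣ ≟ suc k

  Σsize : (m k : ℕ) → (Subset m → ℕ) → ℕ
  Σsize m k f = sum (map f (subsetsOfSize m k))

  Σsize-zero : ∀ m (f : Subset (suc m) → ℕ) → Σsize (suc m) 0 f ≡ Σsize m 0 (f ∘ (outside ∷_))
  Σsize-zero m f = begin
    sum (map f (subsetsOfSize (suc m) 0))                  ≡⟨ cong (sum ∘ map f) (subsetsOfSize-zero m) ⟩
    sum (map f (map (outside ∷_) (subsetsOfSize m 0)))     ≡⟨ cong sum (map-∘ (subsetsOfSize m 0)) ⟨
    Σsize m 0 (f ∘ (outside ∷_))                           ∎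
    where open ≡-Reasoning

  Σsize-suc : ∀ m k (f : Subset (suc m) → ℕ) →
              Σsize (suc m) (suc k) f ≡ Σsize m (suc k) (f ∘ (outside ∷_)) + Σsize m k (f ∘ (inside ∷_))
  Σsize-suc m k f = begin
    sum (map f (subsetsOfSize (suc m) (suc k)))            ≡⟨ cong (sum ∘ map f) (subsetsOfSize-suc m k) ⟩
    sum (map f (map (outside ∷_) S₊ ++ map (inside ∷_) S)) ≡⟨ cong sum (map-++ f (map (outside ∷_) S₊) (map (inside ∷_) S)) ⟩
    sum (map f (map (outside ∷_) S₊) ++ map f (map (inside ∷_) S))
                                                           ≡⟨ sum-++ (map f (map (outside ∷_) S₊)) (map f (map (inside ∷_) S)) ⟩
    sum (map f (map (outside ∷_) S₊)) + sum (map f (map (inside ∷_) S))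
                                                           ≡⟨ cong₂ _+_ (cong sum (map-∘ S₊)) (cong sum (map-∘ S)) ⟨
    Σsize m (suc k) (f ∘ (outside ∷_)) + Σsize m k (f ∘ (inside ∷_)) ∎
    where
    open ≡-Reasoning
    S₊ = subsetsOfSize m (suc k)
    S  = subsetsOfSize m k

  Σsize-+ : ∀ m k (f g : Subset m → ℕ) → Σsize m k (λ A → f A + g A) ≡ Σsize m k f + Σsize m k g
  Σsize-+ m k f g = sum-map-+ (subsetsOfSize m k)
    where
    sum-map-+ : ∀ xs → sum (map (λ A → f A + g A) xs) ≡ sum (map f xs) + sum (map g xs)
    sum-map-+ []       = refl
    sum-map-+ (x ∷ xs) = begin
      f x + g x + sum (map (λ A → f A + g A) xs)           ≡⟨ cong (f x + g x +_) (sum-map-+ xs) ⟩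
      f x + g x + (sum (map f xs) + sum (map g xs))        ≡⟨ solve 4 (λ a b c d → a :+ b :+ (c :+ d) := a :+ c :+ (b :+ d)) refl (f x) (g x) (sum (map f xs)) (sum (map g xs)) ⟩
      f x + sum (map f xs) + (g x + sum (map g xs))        ∎
      where
      open ≡-Reasoning
      open +-*-Solver

  weighted-pascal : ∀ b m k j → b ≤ m →
                    choose b j * supersets m (suc k) j + choose b j * supersets m k j ≡ choose b j * supersets (suc m) (suc k) j
  weighted-pascal b m k j b≤m with j ≤? b
  ... | yes j≤b = trans (sym (*-distribˡ-+ (choose b j) _ _)) (cong (choose b j *_) (sym (supersets-pascal m k j (≤-trans j≤b b≤m))))
  ... | no  j≰b rewrite choose-vanishes b j (≰⇒> j≰b) = refl

  commonSubsets : ∀ {m} → Subset m → ℕ → Subset m → ℕ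
  commonSubsets B j A = choose ∣ B ∩ A ∣ j

  -- Induction on m, splitting the k-subsets by whether they contain the
  -- first point; when it lies in B ∩ A, Pascal's rule splits C(|B ∩ A|, j).
  count-intersections : ∀ m (B : Subset m) k j → Σsize m k (commonSubsets B j) ≡ choose ∣ B ∣ j * supersets m k j
  count-intersections zero    []            zero    zero    = refl
  count-intersections zero    []            zero    (suc j) = refl
  count-intersections zero    []            (suc k) zero    = refl
  count-intersections zero    []            (suc k) (suc j) = refl
  count-intersections (suc m) (outside ∷ B) zero    j       =
    trans (Σsize-zero m _) (trans (count-intersections m B zero j) (cong (choose ∣ B ∣ j *_) (sym (supersets-empty m j))))
  count-intersections (suc m) (outside ∷ B) (suc k) j       =
    trans (Σsize-suc m k _) (trans (cong₂ _+_ (count-intersections m B (suc k) j) (count-intersections m B k j))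
                                   (weighted-pascal ∣ B ∣ m k j (∣p∣≤n B)))
  count-intersections (suc m) (inside ∷ B)  zero    zero    = trans (Σsize-zero m _) (count-intersections m B zero zero)
  count-intersections (suc m) (inside ∷ B)  (suc k) zero    =
    trans (Σsize-suc m k _) (trans (cong₂ _+_ (count-intersections m B (suc k) zero) (count-intersections m B k zero))
                                   (weighted-pascal ∣ B ∣ m k zero (∣p∣≤n B)))
  count-intersections (suc m) (inside ∷ B)  zero    (suc j) = begin
    Σsize (suc m) 0 (commonSubsets (inside ∷ B) (suc j))         ≡⟨ Σsize-zero m _ ⟩
    Σsize m 0 (commonSubsets B (suc j))                          ≡⟨ count-intersections m B zero (suc j) ⟩
    choose b (suc j) * supersets m 0 (suc j)                     ≡⟨ cong (choose b (suc j) *_) (supersets-vanishes m 0 (suc j) (s≤s z≤n)) ⟩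
    choose b (suc j) * 0                                         ≡⟨ *-zeroʳ (choose b (suc j)) ⟩
    0                                                            ≡⟨ *-zeroʳ (choose (suc b) (suc j)) ⟨
    choose (suc b) (suc j) * 0                                   ∎
    where
    open ≡-Reasoning
    b = ∣ B ∣
  count-intersections (suc m) (inside ∷ B)  (suc k) (suc j) = begin
    Σsize (suc m) (suc k) (commonSubsets (inside ∷ B) (suc j))
      ≡⟨ Σsize-suc m k _ ⟩
    Σsize m (suc k) (commonSubsets B (suc j)) + Σsize m k (λ A → commonSubsets B j A + commonSubsets B (suc j) A)
      ≡⟨ cong (Σsize m (suc k) (commonSubsets B (suc j)) +_) (Σsize-+ m k _ _) ⟩
    Σsize m (suc k) (commonSubsets B (suc j)) + (Σsize m k (commonSubsets B j) + Σsize m k (commonSubsets B (suc j)))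
      ≡⟨ cong₂ (λ x y → x + (y + Σsize m k (commonSubsets B (suc j)))) (count-intersections m B (suc k) (suc j)) (count-intersections m B k j) ⟩
    c₊ * supersets m (suc k) (suc j) + (c * supersets m k j + Σsize m k (commonSubsets B (suc j)))
      ≡⟨ cong (λ x → c₊ * supersets m (suc k) (suc j) + (c * supersets m k j + x)) (count-intersections m B k (suc j)) ⟩
    c₊ * supersets m (suc k) (suc j) + (c * supersets m k j + c₊ * supersets m k (suc j))
      ≡⟨ solve 3 (λ x y z → x :+ (y :+ z) := y :+ (x :+ z)) refl (c₊ * supersets m (suc k) (suc j)) (c * supersets m k j) (c₊ * supersets m k (suc j)) ⟩
    c * supersets m k j + (c₊ * supersets m (suc k) (suc j) + c₊ * supersets m k (suc j))
      ≡⟨ cong (c * supersets m k j +_) (weighted-pascal ∣ B ∣ m k (suc j) (∣p∣≤n B)) ⟩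
    c * supersets m k j + c₊ * supersets m k j
      ≡⟨ *-distribʳ-+ (supersets m k j) c c₊ ⟨
    (c + c₊) * supersets m k j ∎
    where
    open ≡-Reasoning
    open +-*-Solver
    c  = choose ∣ B ∣ j
    c₊ = choose ∣ B ∣ (suc j)

module RationalAlgebra where
  open import Data.Nat as ℕ using (zero; suc; _∸_)
  import Data.Nat.Properties as ℕ
  open import Data.Nat.ListAction using (sum)
  import Data.Integer as ℤ
  import Data.Integer.Properties as ℤ
  import Data.Nat.Coprimality as Coprimality
  open import Data.Rational using (ℚ; mkℚ; ↥_; _+_; _*_; -_; 0ℚ; 1ℚ; _≟_; 1/_; ≢-nonZero)
  open import Data.Rational.Properties
    using (normalize-coprime; /-cong; +-identityʳ; +-identityˡ; +-assoc; *-zeroˡ; *-zeroʳ; *-identityˡ;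
           *-distribˡ-+; *-distribʳ-+; *-assoc; *-inverseˡ; *-inverseʳ)
  open import Data.Rational.Solver using (module +-*-Solver)
  open import Data.List using (List; []; _∷_; map; _++_; concatMap; length)
  open import Relation.Nullary using (yes; no)
  open import Relation.Binary.PropositionalEquality
  open import Data.Empty using (⊥-elim)
  open import Function using (_∘_)
  open +-*-Solver

  -- The embedding ℕ → ℚ is an injective semiring homomorphism; ℕtoℚ n is
  -- already the normal form n/1.
  ℕtoℚ-mkℚ : ∀ n → ℕtoℚ n ≡ mkℚ (ℤ.+ n) 0 (Coprimality.sym (Coprimality.1-coprimeTo n))
  ℕtoℚ-mkℚ n = normalize-coprime (Coprimality.sym (Coprimality.1-coprimeTo n))

  ℕtoℚ-+ : ∀ a b → ℕtoℚ (a ℕ.+ b) ≡ ℕtoℚ a + ℕtoℚ b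
  ℕtoℚ-+ a b rewrite ℕtoℚ-mkℚ a | ℕtoℚ-mkℚ b =
    /-cong {p₁ = ℤ.+ (a ℕ.+ b)} (trans (ℤ.pos-+ a b) (sym (cong₂ ℤ._+_ (ℤ.*-identityʳ (ℤ.+ a)) (ℤ.*-identityʳ (ℤ.+ b))))) refl

  ℕtoℚ-* : ∀ a b → ℕtoℚ (a ℕ.* b) ≡ ℕtoℚ a * ℕtoℚ b
  ℕtoℚ-* a b rewrite ℕtoℚ-mkℚ a | ℕtoℚ-mkℚ b = /-cong {p₁ = ℤ.+ (a ℕ.* b)} (ℤ.pos-* a b) refl

  ℕtoℚ-nonzero : ∀ n → n ≢ 0 → ℕtoℚ n ≢ 0ℚ
  ℕtoℚ-nonzero n n≢0 eq = n≢0 (ℤ.+-injective (cong ↥_ (trans (sym (ℕtoℚ-mkℚ n)) eq)))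

  ℕtoℚ-∸ : ∀ m j → j ℕ.≤ m → - ℕtoℚ m + ℕtoℚ j ≡ - ℕtoℚ (m ∸ j)
  ℕtoℚ-∸ m j j≤m = begin
    - ℕtoℚ m + ℕtoℚ j                   ≡⟨ cong (λ x → - ℕtoℚ x + ℕtoℚ j) (ℕ.m∸n+n≡m j≤m) ⟨
    - ℕtoℚ (m ∸ j ℕ.+ j) + ℕtoℚ j       ≡⟨ cong (λ x → - x + ℕtoℚ j) (ℕtoℚ-+ (m ∸ j) j) ⟩
    - (ℕtoℚ (m ∸ j) + ℕtoℚ j) + ℕtoℚ j  ≡⟨ solve 2 (λ d j → :- (d :+ j) :+ j := :- d) refl (ℕtoℚ (m ∸ j)) (ℕtoℚ j) ⟩
    - ℕtoℚ (m ∸ j)                      ∎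
    where open ≡-Reasoning

  Σ≤-cong : ∀ N {f g : ℕ → ℚ} → (∀ j → f j ≡ g j) → Σ≤ N f ≡ Σ≤ N g
  Σ≤-cong zero    f≡g = f≡g 0
  Σ≤-cong (suc N) f≡g = cong₂ _+_ (Σ≤-cong N f≡g) (f≡g (suc N))

  Σ≤-+ : ∀ N (f g : ℕ → ℚ) → Σ≤ N (λ j → f j + g j) ≡ Σ≤ N f + Σ≤ N g
  Σ≤-+ zero    f g = refl
  Σ≤-+ (suc N) f g rewrite Σ≤-+ N f g =
    solve 4 (λ a b c d → (a :+ b) :+ (c :+ d) := (a :+ c) :+ (b :+ d)) refl (Σ≤ N f) (Σ≤ N g) (f (suc N)) (g (suc N))

  Σ≤-*ˡ : ∀ N (c : ℚ) (f : ℕ → ℚ) → Σ≤ N (λ j → c * f j) ≡ c * Σ≤ N f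
  Σ≤-*ˡ zero    c f = refl
  Σ≤-*ˡ (suc N) c f rewrite Σ≤-*ˡ N c f = sym (*-distribˡ-+ c (Σ≤ N f) (f (suc N)))

  Σ≤-head : ∀ N (f : ℕ → ℚ) → Σ≤ (suc N) f ≡ f 0 + Σ≤ N (f ∘ suc)
  Σ≤-head zero    f = refl
  Σ≤-head (suc N) f rewrite Σ≤-head N f = +-assoc (f 0) _ _

  Σ≤-only-head : ∀ N (f : ℕ → ℚ) → (∀ j → f (suc j) ≡ 0ℚ) → Σ≤ N f ≡ f 0
  Σ≤-only-head zero    f vanish = refl
  Σ≤-only-head (suc N) f vanish rewrite Σ≤-only-head N f vanish | vanish N = +-identityʳ (f 0)

  sum-++ : ∀ {A : Set} (g : A → ℚ) (xs ys : List A) → sumℚ (map g (xs ++ ys)) ≡ sumℚ (map g xs) + sumℚ (map g ys)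
  sum-++ g []       ys = sym (+-identityˡ _)
  sum-++ g (x ∷ xs) ys rewrite sum-++ g xs ys = sym (+-assoc (g x) _ _)

  sum-concatMap : ∀ {A B : Set} (g : B → ℚ) (h : A → List B) (xs : List A) →
                  sumℚ (map g (concatMap h xs)) ≡ sumℚ (map (λ x → sumℚ (map g (h x))) xs)
  sum-concatMap g h []       = refl
  sum-concatMap g h (x ∷ xs) = trans (sum-++ g (h x) _) (cong (sumℚ (map g (h x)) +_) (sum-concatMap g h xs))

  sum-Σ≤ : ∀ {A : Set} N (f : A → ℕ → ℚ) (xs : List A) →
           sumℚ (map (λ x → Σ≤ N (f x)) xs) ≡ Σ≤ N (λ j → sumℚ (map (λ x → f x j) xs))
  sum-Σ≤ N f []       = sym (Σ≤-only-head N (λ _ → 0ℚ) (λ _ → refl))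
  sum-Σ≤ N f (x ∷ xs) rewrite sum-Σ≤ N f xs = sym (Σ≤-+ N (f x) _)

  sum-*ʳ : ∀ {A : Set} (f : A → ℚ) (c : ℚ) (xs : List A) → sumℚ (map (λ x → f x * c) xs) ≡ sumℚ (map f xs) * c
  sum-*ʳ f c []       = sym (*-zeroˡ c)
  sum-*ʳ f c (x ∷ xs) rewrite sum-*ʳ f c xs = sym (*-distribʳ-+ c (f x) _)

  sum-ℕtoℚ : ∀ {A : Set} (f : A → ℕ) (xs : List A) → sumℚ (map (ℕtoℚ ∘ f) xs) ≡ ℕtoℚ (sum (map f xs))
  sum-ℕtoℚ f []       = refl
  sum-ℕtoℚ f (x ∷ xs) rewrite sum-ℕtoℚ f xs = sym (ℕtoℚ-+ (f x) _)

  sum-ones : ∀ {A : Set} (xs : List A) → sumℚ (map (λ _ → 1ℚ) xs) ≡ ℕtoℚ (length xs)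
  sum-ones []       = refl
  sum-ones (x ∷ xs) = trans (cong (1ℚ +_) (sum-ones xs)) (sym (ℕtoℚ-+ 1 (length xs)))

  product-* : ∀ {A : Set} (f g : A → ℚ) (xs : List A) →
              productℚ (map f xs) * productℚ (map g xs) ≡ productℚ (map (λ x → f x * g x) xs)
  product-* f g []       = refl
  product-* f g (x ∷ xs) rewrite sym (product-* f g xs) =
    solve 4 (λ a b c d → (a :* c) :* (b :* d) := (a :* b) :* (c :* d)) refl (f x) (g x) (productℚ (map f xs)) (productℚ (map g xs))

  product-const : ∀ {A : Set} (c : ℚ) (xs : List A) → productℚ (map (λ _ → c) xs) ≡ c ^ℚ length xs
  product-const c []       = refl
  product-const c (x ∷ xs) = cong (c *_) (product-const c xs)

  *-nonzero : ∀ x y → x ≢ 0ℚ → y ≢ 0ℚ → x * y ≢ 0ℚ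
  *-nonzero x y x≢0 y≢0 xy≡0 = y≢0 (begin
    y                ≡⟨ *-identityˡ y ⟨
    1ℚ * y           ≡⟨ cong (_* y) (*-inverseˡ x {{≢-nonZero x≢0}}) ⟨
    (x⁻¹ * x) * y    ≡⟨ *-assoc x⁻¹ x y ⟩
    x⁻¹ * (x * y)    ≡⟨ cong (x⁻¹ *_) xy≡0 ⟩
    x⁻¹ * 0ℚ         ≡⟨ *-zeroʳ x⁻¹ ⟩
    0ℚ               ∎)
    where
    open ≡-Reasoning
    x⁻¹ = (1/ x) {{≢-nonZero x≢0}}

  cancel-nonzero : ∀ x y → x * y ≡ 0ℚ → y ≢ 0ℚ → x ≡ 0ℚ
  cancel-nonzero x y xy≡0 y≢0 with x ≟ 0ℚ
  ... | yes x≡0 = x≡0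
  ... | no  x≢0 = ⊥-elim (*-nonzero x y x≢0 y≢0 xy≡0)

  pow-nonzero : ∀ x n → x ≢ 0ℚ → x ^ℚ n ≢ 0ℚ
  pow-nonzero x zero    x≢0 ()
  pow-nonzero x (suc n) x≢0 = *-nonzero x (x ^ℚ n) x≢0 (pow-nonzero x n x≢0)

  divℚ-* : ∀ p q → divℚ p q ≡ p * divℚ 1ℚ q
  divℚ-* p q with q ≟ 0ℚ
  ... | yes _ = sym (*-zeroʳ p)
  ... | no  _ = cong (p *_) (sym (*-identityˡ _))

  divℚ-inverse : ∀ q → q ≢ 0ℚ → q * divℚ 1ℚ q ≡ 1ℚ
  divℚ-inverse q q≢0 with q ≟ 0ℚ
  ... | yes q≡0 = ⊥-elim (q≢0 q≡0)
  ... | no  q≢0 = trans (cong (q *_) (*-identityˡ _)) (*-inverseʳ q {{≢-nonZero q≢0}})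

  pow-* : ∀ a b j → (a * b) ^ℚ j ≡ (a ^ℚ j) * (b ^ℚ j)
  pow-* a b zero    = refl
  pow-* a b (suc j) rewrite pow-* a b j =
    solve 4 (λ a b x y → (a :* b) :* (x :* y) := (a :* x) :* (b :* y)) refl a b (a ^ℚ j) (b ^ℚ j)

  sign-square : ∀ j → ((- 1ℚ) ^ℚ j) * ((- 1ℚ) ^ℚ j) ≡ 1ℚ
  sign-square zero    = refl
  sign-square (suc j) = trans (solve 1 (λ s → (:- con 1ℚ :* s) :* (:- con 1ℚ :* s) := s :* s) refl ((- 1ℚ) ^ℚ j)) (sign-square j)

  one-pow : ∀ n → 1ℚ ^ℚ n ≡ 1ℚ
  one-pow zero    = refl
  one-pow (suc n) = trans (*-identityˡ _) (one-pow n)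

module FactorialMoments where
  open Binomial
  open Counting using (Σsize; commonSubsets; count-intersections)
  open RationalAlgebra
  open import Data.Nat using (zero; suc; s≤s)
  import Data.Nat as ℕ
  open import Data.Rational using (ℚ; _+_; _*_; _-_; 0ℚ; 1ℚ)
  open import Data.Rational.Properties using (*-zeroˡ; *-identityˡ; *-identityʳ; +-identityʳ)
  open import Data.Rational.Solver using (module +-*-Solver)
  open import Data.List using (List; map; concatMap; length)
  open import Data.List.Properties using (map-∘; map-cong)
  open import Data.Vec using ([]; _∷_; toList)
  open import Data.Fin using (zero; suc)
  open import Data.Fin.Subset using (Subset; ∣_∣; _∩_; ⋂; ⊤)
  open import Data.Fin.Subset.Properties using (∣p∣≤n; ∩-assoc; ∩-identityˡ; ∩-identityʳ; ∣⊤∣≡n)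
  open import Relation.Binary.PropositionalEquality
  open import Function using (_∘_)
  open +-*-Solver

  binomial-theorem : ∀ (w : ℚ) N b → b ≤ N → (1ℚ + w) ^ℚ b ≡ Σ≤ N (λ j → ℕtoℚ (choose b j) * (w ^ℚ j))
  binomial-theorem w N zero _ =
    sym (trans (Σ≤-only-head N (λ j → ℕtoℚ (choose 0 j) * (w ^ℚ j)) (λ j → *-zeroˡ (w ^ℚ suc j))) (*-identityˡ 1ℚ))
  binomial-theorem w (suc N) (suc b) (s≤s b≤N) = begin
    (1ℚ + w) * ((1ℚ + w) ^ℚ b)           ≡⟨ cong ((1ℚ + w) *_) (binomial-theorem w N b b≤N) ⟩
    (1ℚ + w) * Σ≤ N g                    ≡⟨ cong ((1ℚ + w) *_) g-sum ⟩
    (1ℚ + w) * (1ℚ + R)                  ≡⟨ solve 2 (λ w R → (con 1ℚ :+ w) :* (con 1ℚ :+ R) := con 1ℚ :+ (w :* (con 1ℚ :+ R) :+ R)) refl w R ⟩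
    1ℚ + (w * (1ℚ + R) + R)              ≡⟨ cong (λ x → 1ℚ + (w * x + R)) g-sum ⟨
    1ℚ + (w * Σ≤ N g + R)                ≡⟨ cong (λ x → 1ℚ + (x + R)) (Σ≤-*ˡ N w g) ⟨
    1ℚ + (Σ≤ N (λ j → w * g j) + R)      ≡⟨ cong (1ℚ +_) (Σ≤-+ N (λ j → w * g j) (g ∘ suc)) ⟨
    1ℚ + Σ≤ N (λ j → w * g j + g (suc j)) ≡⟨ cong (1ℚ +_) (Σ≤-cong N pascal) ⟩
    1ℚ + Σ≤ N (h ∘ suc)                  ≡⟨ Σ≤-head N h ⟨
    Σ≤ (suc N) h                         ∎
    where
    open ≡-Reasoning
    g = λ j → ℕtoℚ (choose b j) * (w ^ℚ j)
    h = λ j → ℕtoℚ (choose (suc b) j) * (w ^ℚ j)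
    R = Σ≤ N (g ∘ suc)
    last-term : g (suc N) ≡ 0ℚ
    last-term = trans (cong (λ c → ℕtoℚ c * (w ^ℚ suc N)) (choose-vanishes b (suc N) (s≤s b≤N))) (*-zeroˡ (w ^ℚ suc N))
    g-sum : Σ≤ N g ≡ 1ℚ + R
    g-sum = begin
      Σ≤ N g               ≡⟨ +-identityʳ _ ⟨
      Σ≤ N g + 0ℚ          ≡⟨ cong (Σ≤ N g +_) last-term ⟨
      Σ≤ (suc N) g         ≡⟨ Σ≤-head N g ⟩
      g 0 + R              ≡⟨ cong (_+ R) (*-identityˡ 1ℚ) ⟩
      1ℚ + R               ∎
    pascal : ∀ j → w * g j + g (suc j) ≡ h (suc j)
    pascal j rewrite ℕtoℚ-+ (choose b j) (choose b (suc j)) =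
      solve 4 (λ w a b p → w :* (a :* p) :+ b :* (w :* p) := (a :+ b) :* (w :* p)) refl w (ℕtoℚ (choose b j)) (ℕtoℚ (choose b (suc j))) (w ^ℚ j)

  -- Π_d S(m, k_d, j): the number of tuples (A_d), |A_d| = k_d, all containing a fixed j-set.
  jointSupersets : ℕ → List ℕ → ℕ → ℚ
  jointSupersets m ks j = productℚ (map (λ k → ℕtoℚ (supersets m k j)) ks)

  -- Σ_{(A_d)} z^{|B ∩ ⋂ A_d|}; for B = [m] this is the numerator of the pgf of X_∩.
  weightedCount : (m : ℕ) (z : ℚ) {c : ℕ} → Subset m → Vec ℕ c → ℚ
  weightedCount m z B ks = sumℚ (map (λ As → z ^ℚ ∣ B ∩ ⋂ (toList As) ∣) (tuples m ks))

  count-intersectionsℚ : ∀ m (B : Subset m) k j (t : ℚ) →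
    sumℚ (map (λ A → ℕtoℚ (commonSubsets B j A) * t) (subsetsOfSize m k)) ≡ ℕtoℚ (choose ∣ B ∣ j) * (ℕtoℚ (supersets m k j) * t)
  count-intersectionsℚ m B k j t = begin
    sumℚ (map (λ A → ℕtoℚ (commonSubsets B j A) * t) (subsetsOfSize m k))
      ≡⟨ sum-*ʳ (ℕtoℚ ∘ commonSubsets B j) t (subsetsOfSize m k) ⟩
    sumℚ (map (ℕtoℚ ∘ commonSubsets B j) (subsetsOfSize m k)) * t
      ≡⟨ cong (_* t) (sum-ℕtoℚ (commonSubsets B j) (subsetsOfSize m k)) ⟩
    ℕtoℚ (Σsize m k (commonSubsets B j)) * t
      ≡⟨ cong (λ n → ℕtoℚ n * t) (count-intersections m B k j) ⟩
    ℕtoℚ (choose ∣ B ∣ j ℕ.* supersets m k j) * t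
      ≡⟨ cong (_* t) (ℕtoℚ-* (choose ∣ B ∣ j) (supersets m k j)) ⟩
    ℕtoℚ (choose ∣ B ∣ j) * ℕtoℚ (supersets m k j) * t
      ≡⟨ solve 3 (λ a s t → a :* s :* t := a :* (s :* t)) refl (ℕtoℚ (choose ∣ B ∣ j)) (ℕtoℚ (supersets m k j)) t ⟩
    ℕtoℚ (choose ∣ B ∣ j) * (ℕtoℚ (supersets m k j) * t) ∎
    where open ≡-Reasoning

  -- The expansion, by induction on the tuple: fixing A_1 = A replaces B by
  -- B ∩ A, and count-intersections sums the result over A.
  expansion : ∀ m (z : ℚ) {c} (ks : Vec ℕ c) (B : Subset m) →
              weightedCount m z B ks ≡ Σ≤ m (λ j → ℕtoℚ (choose ∣ B ∣ j) * (((z - 1ℚ) ^ℚ j) * jointSupersets m (toList ks) j))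
  expansion m z [] B = begin
    z ^ℚ ∣ B ∩ ⊤ ∣ + 0ℚ                          ≡⟨ +-identityʳ _ ⟩
    z ^ℚ ∣ B ∩ ⊤ ∣                               ≡⟨ cong (λ X → z ^ℚ ∣ X ∣) (∩-identityʳ B) ⟩
    z ^ℚ ∣ B ∣                                   ≡⟨ cong (_^ℚ ∣ B ∣) (solve 1 (λ z → z := con 1ℚ :+ (z :- con 1ℚ)) refl z) ⟩
    (1ℚ + w) ^ℚ ∣ B ∣                            ≡⟨ binomial-theorem w m ∣ B ∣ (∣p∣≤n B) ⟩
    Σ≤ m (λ j → ℕtoℚ (choose ∣ B ∣ j) * (w ^ℚ j)) ≡⟨ Σ≤-cong m (λ j → cong (ℕtoℚ (choose ∣ B ∣ j) *_) (*-identityʳ (w ^ℚ j))) ⟨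
    Σ≤ m (λ j → ℕtoℚ (choose ∣ B ∣ j) * ((w ^ℚ j) * 1ℚ)) ∎
    where
    open ≡-Reasoning
    w = z - 1ℚ
  expansion m z (k ∷ ks) B = begin
    sumℚ (map g (concatMap (λ A → map (A ∷_) (tuples m ks)) S))
      ≡⟨ sum-concatMap g (λ A → map (A ∷_) (tuples m ks)) S ⟩
    sumℚ (map (λ A → sumℚ (map g (map (A ∷_) (tuples m ks)))) S)
      ≡⟨ cong sumℚ (map-cong (λ A → trans (cong sumℚ (sym (map-∘ (tuples m ks)))) (restrict A)) S) ⟩
    sumℚ (map (λ A → Σ≤ m (λ j → ℕtoℚ (commonSubsets B j A) * t j)) S)
      ≡⟨ sum-Σ≤ m (λ A j → ℕtoℚ (commonSubsets B j A) * t j) S ⟩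
    Σ≤ m (λ j → sumℚ (map (λ A → ℕtoℚ (commonSubsets B j A) * t j) S))
      ≡⟨ Σ≤-cong m (λ j → count-intersectionsℚ m B k j (t j)) ⟩
    Σ≤ m (λ j → ℕtoℚ (choose ∣ B ∣ j) * (ℕtoℚ (supersets m k j) * t j))
      ≡⟨ Σ≤-cong m (λ j → cong (ℕtoℚ (choose ∣ B ∣ j) *_) (solve 3 (λ s x p → s :* (x :* p) := x :* (s :* p)) refl (ℕtoℚ (supersets m k j)) (w ^ℚ j) (jointSupersets m (toList ks) j))) ⟩
    Σ≤ m (λ j → ℕtoℚ (choose ∣ B ∣ j) * ((w ^ℚ j) * jointSupersets m (toList (k ∷ ks)) j)) ∎
    where
    open ≡-Reasoning
    w = z - 1ℚ
    S = subsetsOfSize m k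
    g = λ (As : Vec (Subset m) _) → z ^ℚ ∣ B ∩ ⋂ (toList As) ∣
    t = λ j → (w ^ℚ j) * jointSupersets m (toList ks) j
    restrict : ∀ A → sumℚ (map (g ∘ (A ∷_)) (tuples m ks)) ≡ Σ≤ m (λ j → ℕtoℚ (commonSubsets B j A) * t j)
    restrict A = trans (cong sumℚ (map-cong (λ As → cong (λ X → z ^ℚ ∣ X ∣) (sym (∩-assoc B A (⋂ (toList As))))) (tuples m ks)))
                       (expansion m z ks (B ∩ A))

  pgf-numerator : ∀ m (z : ℚ) {c} (ks : Vec ℕ c) →
                  sumℚ (map (λ As → z ^ℚ Xcap As) (tuples m ks)) ≡
                  Σ≤ m (λ j → ℕtoℚ (choose m j) * (((z - 1ℚ) ^ℚ j) * jointSupersets m (toList ks) j))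
  pgf-numerator m z ks = begin
    sumℚ (map (λ As → z ^ℚ Xcap As) (tuples m ks))
      ≡⟨ cong sumℚ (map-cong (λ As → cong (λ X → z ^ℚ ∣ X ∣) (∩-identityˡ (⋂ (toList As)))) (tuples m ks)) ⟨
    weightedCount m z ⊤ ks
      ≡⟨ expansion m z ks ⊤ ⟩
    Σ≤ m (λ j → ℕtoℚ (choose ∣ ⊤ {m} ∣ j) * (((z - 1ℚ) ^ℚ j) * jointSupersets m (toList ks) j))
      ≡⟨ Σ≤-cong m (λ j → cong (λ b → ℕtoℚ (choose b j) * (((z - 1ℚ) ^ℚ j) * jointSupersets m (toList ks) j)) (∣⊤∣≡n m)) ⟩
    Σ≤ m (λ j → ℕtoℚ (choose m j) * (((z - 1ℚ) ^ℚ j) * jointSupersets m (toList ks) j)) ∎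
    where open ≡-Reasoning

  number-of-tuples : ∀ m {c} (ks : Vec ℕ c) → ℕtoℚ (length (tuples m ks)) ≡ jointSupersets m (toList ks) 0
  number-of-tuples m ks = begin
    ℕtoℚ (length (tuples m ks))                           ≡⟨ sum-ones (tuples m ks) ⟨
    sumℚ (map (λ _ → 1ℚ) (tuples m ks))                   ≡⟨ cong sumℚ (map-cong (λ As → one-pow (Xcap As)) (tuples m ks)) ⟨
    sumℚ (map (λ As → 1ℚ ^ℚ Xcap As) (tuples m ks))       ≡⟨ pgf-numerator m 1ℚ ks ⟩
    Σ≤ m (λ j → ℕtoℚ (choose m j) * ((0ℚ ^ℚ j) * P j))    ≡⟨ Σ≤-only-head m _ higher-terms ⟩
    1ℚ * (1ℚ * P 0)                                       ≡⟨ solve 1 (λ p → con 1ℚ :* (con 1ℚ :* p) := p) refl (P 0) ⟩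
    P 0                                                   ∎
    where
    open ≡-Reasoning
    P = jointSupersets m (toList ks)
    higher-terms : ∀ j → ℕtoℚ (choose m (suc j)) * ((0ℚ ^ℚ suc j) * P (suc j)) ≡ 0ℚ
    higher-terms j = solve 3 (λ c x p → c :* ((con 0ℚ :* x) :* p) := con 0ℚ) refl (ℕtoℚ (choose m (suc j))) (0ℚ ^ℚ j) (P (suc j))

  tuples-exist : ∀ m {c} (ks : Vec ℕ c) → (∀ d → lookup ks d ≤ m) → jointSupersets m (toList ks) 0 ≢ 0ℚ
  tuples-exist m []       _ ()
  tuples-exist m (k ∷ ks) k≤m = *-nonzero _ _ (ℕtoℚ-nonzero _ (choose-nonzero m k (k≤m zero))) (tuples-exist m ks (k≤m ∘ suc))

-- With P_j = Π_d S(m, k_d, j) over the sizes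
-- k₀ ∷ ks, the pgf is Σ_j C(m,j) P_j (z-1)^j / P_0, i.e. Σ_j u_j (-(z-1))^j with
--   u_j = (-1)^j C(m,j) P_j / P_0 .
-- The ratio u_{j+1}/u_j is that of ₚF_q with numerator parameters -k_d and
-- c-1 denominator parameters -m: both C(m,j) and every S(m,k,j) change by
-- factors (m-j), (k-j) and (j+1) (choose-ratio, supersets-ratio).
module Hypergeometric (m k₀ : ℕ) (ks : List ℕ) where
  open Binomial
  open RationalAlgebra
  open FactorialMoments using (jointSupersets)
  open import Data.Nat as ℕ using (suc; _∸_; _<_; _≤?_)
  import Data.Nat.Properties as ℕ
  open import Data.Rational using (ℚ; _+_; _*_; -_; 0ℚ; 1ℚ)
  import Data.Rational.Properties as ℚ
  open import Data.Rational.Solver using (module +-*-Solver)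
  open import Data.List using (_∷_; map; length)
  open import Data.List.Properties using (map-∘; map-cong)
  open import Relation.Nullary using (Dec; yes; no)
  open import Relation.Binary.PropositionalEquality
  open import Data.Empty using (⊥-elim)
  open import Function using (_∘′_)
  open +-*-Solver

  P : ℕ → ℚ
  P = jointSupersets m (k₀ ∷ ks)

  as bs : List ℚ
  as = map (λ k → - ℕtoℚ k) (k₀ ∷ ks)
  bs = map (λ _ → - ℕtoℚ m) ks

  sign : ℕ → ℚ
  sign j = (- 1ℚ) ^ℚ j

  normalizer : ℚ
  normalizer = divℚ 1ℚ (P 0)

  u : ℕ → ℚ
  u j = sign j * ℕtoℚ (choose m j) * P j * normalizer

  -- min(j - m, 0) = -(m ∸ j): the common factor of the ratios below.
  gap : ℕ → ℚ
  gap j = - ℕtoℚ (m ∸ j)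

  gap-vanishes : ∀ j → m < j → gap j ≡ 0ℚ
  gap-vanishes j m<j = cong (λ n → - ℕtoℚ n) (ℕ.m≤n⇒m∸n≡0 (ℕ.<⇒≤ m<j))

  supersets-ratioℚ : ∀ k j → ℕtoℚ (supersets m k j) * (- ℕtoℚ k + ℕtoℚ j) ≡ ℕtoℚ (supersets m k (suc j)) * gap j
  supersets-ratioℚ k j with j ≤? k
  ... | yes j≤k = begin
    ℕtoℚ (supersets m k j) * (- ℕtoℚ k + ℕtoℚ j)           ≡⟨ cong (ℕtoℚ (supersets m k j) *_) (ℕtoℚ-∸ k j j≤k) ⟩
    ℕtoℚ (supersets m k j) * - ℕtoℚ (k ∸ j)                 ≡⟨ ℚ.neg-distribʳ-* (ℕtoℚ (supersets m k j)) (ℕtoℚ (k ∸ j)) ⟨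
    - (ℕtoℚ (supersets m k j) * ℕtoℚ (k ∸ j))               ≡⟨ cong -_ (ℕtoℚ-* (supersets m k j) (k ∸ j)) ⟨
    - ℕtoℚ (supersets m k j ℕ.* (k ∸ j))                    ≡⟨ cong (-_ ∘′ ℕtoℚ) (supersets-ratio m k j) ⟨
    - ℕtoℚ (supersets m k (suc j) ℕ.* (m ∸ j))              ≡⟨ cong -_ (ℕtoℚ-* (supersets m k (suc j)) (m ∸ j)) ⟩
    - (ℕtoℚ (supersets m k (suc j)) * ℕtoℚ (m ∸ j))         ≡⟨ ℚ.neg-distribʳ-* (ℕtoℚ (supersets m k (suc j))) (ℕtoℚ (m ∸ j)) ⟩
    ℕtoℚ (supersets m k (suc j)) * gap j                    ∎
    where open ≡-Reasoning
  ... | no j≰k rewrite supersets-vanishes m k j (ℕ.≰⇒> j≰k) | supersets-vanishes m k (suc j) (ℕ.m≤n⇒m≤1+n (ℕ.≰⇒> j≰k)) =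
    trans (ℚ.*-zeroˡ (- ℕtoℚ k + ℕtoℚ j)) (sym (ℚ.*-zeroˡ (gap j)))

  numerator-ratio : ∀ j → P j * shiftedProd as j ≡ P (suc j) * (gap j ^ℚ length (k₀ ∷ ks))
  numerator-ratio j = begin
    P j * productℚ (map (λ x → x + ℕtoℚ j) (map (λ k → - ℕtoℚ k) (k₀ ∷ ks)))
      ≡⟨ cong (λ xs → P j * productℚ xs) (map-∘ {g = λ x → x + ℕtoℚ j} {f = λ k → - ℕtoℚ k} (k₀ ∷ ks)) ⟨
    P j * productℚ (map (λ k → - ℕtoℚ k + ℕtoℚ j) (k₀ ∷ ks))
      ≡⟨ product-* (λ k → ℕtoℚ (supersets m k j)) (λ k → - ℕtoℚ k + ℕtoℚ j) (k₀ ∷ ks) ⟩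
    productℚ (map (λ k → ℕtoℚ (supersets m k j) * (- ℕtoℚ k + ℕtoℚ j)) (k₀ ∷ ks))
      ≡⟨ cong productℚ (map-cong (λ k → supersets-ratioℚ k j) (k₀ ∷ ks)) ⟩
    productℚ (map (λ k → ℕtoℚ (supersets m k (suc j)) * gap j) (k₀ ∷ ks))
      ≡⟨ product-* (λ k → ℕtoℚ (supersets m k (suc j))) (λ _ → gap j) (k₀ ∷ ks) ⟨
    P (suc j) * productℚ (map (λ _ → gap j) (k₀ ∷ ks))
      ≡⟨ cong (P (suc j) *_) (product-const (gap j) (k₀ ∷ ks)) ⟩
    P (suc j) * (gap j ^ℚ length (k₀ ∷ ks)) ∎
    where open ≡-Reasoning

  denominator-ratio : ∀ j → gap j * shiftedProd bs j ≡ gap j ^ℚ length (k₀ ∷ ks)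
  denominator-ratio j = begin
    gap j * productℚ (map (λ x → x + ℕtoℚ j) (map (λ _ → - ℕtoℚ m) ks)) ≡⟨ cong (λ xs → gap j * productℚ xs) (map-∘ {g = λ x → x + ℕtoℚ j} {f = λ _ → - ℕtoℚ m} ks) ⟨
    gap j * productℚ (map (λ _ → - ℕtoℚ m + ℕtoℚ j) ks)                ≡⟨ cong (gap j *_) (product-const _ ks) ⟩
    gap j * ((- ℕtoℚ m + ℕtoℚ j) ^ℚ length ks)                         ≡⟨ truncate (j ≤? m) ⟩
    gap j * (gap j ^ℚ length ks)                                       ∎
    where
    open ≡-Reasoning
    -- for j > m both sides vanish, as gap j = 0
    truncate : Dec (j ℕ.≤ m) → gap j * ((- ℕtoℚ m + ℕtoℚ j) ^ℚ length ks) ≡ gap j * (gap j ^ℚ length ks)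
    truncate (yes j≤m) = cong (λ x → gap j * (x ^ℚ length ks)) (ℕtoℚ-∸ m j j≤m)
    truncate (no  j≰m) rewrite gap-vanishes j (ℕ.≰⇒> j≰m) =
      trans (ℚ.*-zeroˡ ((- ℕtoℚ m + ℕtoℚ j) ^ℚ length ks)) (sym (ℚ.*-zeroˡ (0ℚ ^ℚ length ks)))

  choose-ratioℚ : ∀ j → ℕtoℚ (choose m (suc j)) * ℕtoℚ (suc j) ≡ ℕtoℚ (choose m j) * ℕtoℚ (m ∸ j)
  choose-ratioℚ j = trans (sym (ℕtoℚ-* (choose m (suc j)) (suc j)))
                          (trans (cong ℕtoℚ (choose-ratio m j)) (ℕtoℚ-* (choose m j) (m ∸ j)))

  u-step : ∀ j → u (suc j) * (shiftedProd bs j * ℕtoℚ (suc j)) ≡ u j * shiftedProd as j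
  u-step j = begin
    u (suc j) * (Πb * ℕtoℚ (suc j))
      ≡⟨ solve 6 (λ s c p n b i → (:- con 1ℚ :* s) :* c :* p :* n :* (b :* i) := :- (s :* n) :* (c :* i) :* p :* b)
               refl (sign j) (ℕtoℚ (choose m (suc j))) (P (suc j)) normalizer Πb (ℕtoℚ (suc j)) ⟩
    - (sign j * normalizer) * (ℕtoℚ (choose m (suc j)) * ℕtoℚ (suc j)) * P (suc j) * Πb
      ≡⟨ cong (λ x → - (sign j * normalizer) * x * P (suc j) * Πb) (choose-ratioℚ j) ⟩
    - (sign j * normalizer) * (ℕtoℚ (choose m j) * ℕtoℚ (m ∸ j)) * P (suc j) * Πb
      ≡⟨ solve 6 (λ s n c d p b → :- (s :* n) :* (c :* d) :* p :* b := s :* n :* c :* (p :* (:- d :* b)))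
               refl (sign j) normalizer (ℕtoℚ (choose m j)) (ℕtoℚ (m ∸ j)) (P (suc j)) Πb ⟩
    sign j * normalizer * ℕtoℚ (choose m j) * (P (suc j) * (gap j * Πb))
      ≡⟨ cong (λ x → sign j * normalizer * ℕtoℚ (choose m j) * (P (suc j) * x)) (denominator-ratio j) ⟩
    sign j * normalizer * ℕtoℚ (choose m j) * (P (suc j) * (gap j ^ℚ length (k₀ ∷ ks)))
      ≡⟨ cong (sign j * normalizer * ℕtoℚ (choose m j) *_) (numerator-ratio j) ⟨
    sign j * normalizer * ℕtoℚ (choose m j) * (P j * Πa)
      ≡⟨ solve 5 (λ s n c p a → s :* n :* c :* (p :* a) := s :* c :* p :* n :* a) refl (sign j) normalizer (ℕtoℚ (choose m j)) (P j) Πa ⟩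
    u j * Πa ∎
    where
    open ≡-Reasoning
    Πa = shiftedProd as j
    Πb = shiftedProd bs j

  u-vanishes : ∀ j → m < j → u j ≡ 0ℚ
  u-vanishes j m<j rewrite choose-vanishes m j m<j =
    solve 3 (λ s p n → s :* con 0ℚ :* p :* n := con 0ℚ) refl (sign j) (P j) normalizer

  u-initial : P 0 ≢ 0ℚ → u 0 ≡ 1ℚ
  u-initial P₀≢0 = trans (solve 2 (λ p n → con 1ℚ :* con 1ℚ :* p :* n := p :* n) refl (P 0) normalizer)
                         (divℚ-inverse (P 0) P₀≢0)

  bs-nonzero : ∀ j → suc j ℕ.≤ m → shiftedProd bs j ≢ 0ℚ
  bs-nonzero j j<m = subst (_≢ 0ℚ) (sym shifted) (pow-nonzero (gap j) (length ks) gap≢0)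
    where
    shifted : shiftedProd bs j ≡ gap j ^ℚ length ks
    shifted = trans (cong productℚ (sym (map-∘ {g = λ x → x + ℕtoℚ j} {f = λ _ → - ℕtoℚ m} ks)))
                    (trans (product-const _ ks) (cong (_^ℚ length ks) (ℕtoℚ-∸ m j (ℕ.<⇒≤ j<m))))
    gap≢0 : gap j ≢ 0ℚ
    gap≢0 gap≡0 = ℕtoℚ-nonzero (m ∸ j) (ℕ.m>n⇒m∸n≢0 j<m) (ℚ.neg-injective gap≡0)

  u-defined : ∀ j → u (suc j) ≢ 0ℚ → shiftedProd bs j ≢ 0ℚ
  u-defined j u≢0 with suc j ≤? m
  ... | yes j<m = bs-nonzero j j<m
  ... | no  j≮m = ⊥-elim (u≢0 (u-vanishes (suc j) (ℕ.≰⇒> j≮m)))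

  u-stops : ∀ j → u j ≡ 0ℚ → u (suc j) ≡ 0ℚ
  u-stops j u≡0 with suc j ≤? m
  ... | no  j≮m = u-vanishes (suc j) (ℕ.≰⇒> j≮m)
  ... | yes j<m = cancel-nonzero (u (suc j)) (shiftedProd bs j * ℕtoℚ (suc j))
      (trans (u-step j) (trans (cong (_* shiftedProd as j) u≡0) (ℚ.*-zeroˡ (shiftedProd as j))))
      (*-nonzero (shiftedProd bs j) (ℕtoℚ (suc j)) (bs-nonzero j j<m) (ℕtoℚ-nonzero (suc j) λ ()))

  isHypCoeffs : P 0 ≢ 0ℚ → IsHypCoeffs as bs u
  isHypCoeffs P₀≢0 = record
    { initial = u-initial P₀≢0
    ; step    = u-step
    ; defined = u-defined
    ; stops   = u-stops
    }

  hypergeometric-series : ∀ w → Σ≤ m (λ j → ℕtoℚ (choose m j) * ((w ^ℚ j) * P j)) * normalizer ≡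
                                 Σ≤ m (λ j → u j * ((- 1ℚ * w) ^ℚ j))
  hypergeometric-series w = begin
    Σ≤ m t * normalizer          ≡⟨ ℚ.*-comm (Σ≤ m t) normalizer ⟩
    normalizer * Σ≤ m t          ≡⟨ Σ≤-*ˡ m normalizer t ⟨
    Σ≤ m (λ j → normalizer * t j) ≡⟨ Σ≤-cong m term ⟩
    Σ≤ m (λ j → u j * ((- 1ℚ * w) ^ℚ j)) ∎
    where
    open ≡-Reasoning
    t = λ j → ℕtoℚ (choose m j) * ((w ^ℚ j) * P j)
    term : ∀ j → normalizer * t j ≡ u j * ((- 1ℚ * w) ^ℚ j)
    term j = begin
      normalizer * t j                                      ≡⟨ ℚ.*-identityˡ _ ⟨
      1ℚ * (normalizer * t j)                               ≡⟨ cong (_* (normalizer * t j)) (sign-square j) ⟨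
      (sign j * sign j) * (normalizer * t j)                ≡⟨ solve 5 (λ s n c x p → (s :* s) :* (n :* (c :* (x :* p))) := s :* c :* p :* n :* (s :* x))
                                                                     refl (sign j) normalizer (ℕtoℚ (choose m j)) (w ^ℚ j) (P j) ⟩
      u j * (sign j * (w ^ℚ j))                             ≡⟨ cong (u j *_) (pow-* (- 1ℚ) w j) ⟨
      u j * ((- 1ℚ * w) ^ℚ j)                               ∎

open import Data.List using (map; length)
open import Data.Nat using (zero; suc)
open import Data.Vec using (_∷_; toList)
open import Data.Rational using (_*_; _-_; -_; 1ℚ)
open import Data.Product using (_,_)
open import Relation.Binary.PropositionalEquality using (_≡_; cong₂; module ≡-Reasoning)
open FactorialMoments using (pgf-numerator; number-of-tuples; tuples-exist)
open RationalAlgebra using (divℚ-*)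
open Binomial using (choose)

-- The theorem.  For c ≥ 1 sizes the pgf of X_∩ is the terminating series
--   ₚF_q(-k_1, …, -k_c ; -m, …, -m ; -(z-1))      (c-1 denominator parameters -m).
theorem2p10 : (m c : ℕ) → 1 ≤ m → 1 ≤ c → (ks : Vec ℕ c) →
    (∀ d → lookup ks d ≤ m) → IsGHFMD (pgfXcap m ks)
theorem2p10 m zero    _ () ks bound
theorem2p10 m (suc c′) _ _  ks@(k₀ ∷ ks′) bound =
  as , bs , - 1ℚ , u , m , isHypCoeffs (tuples-exist m ks bound) , u-vanishes , pgf-series
  where
  open Hypergeometric m k₀ (toList ks′)
  open ≡-Reasoning
  pgf-series : ∀ z → pgfXcap m ks z ≡ Σ≤ m (λ j → u j * ((- 1ℚ * (z - 1ℚ)) ^ℚ j))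
  pgf-series z = begin
    pgfXcap m ks z
      ≡⟨ divℚ-* (sumℚ (map (λ As → z ^ℚ Xcap As) (tuples m ks))) (ℕtoℚ (length (tuples m ks))) ⟩
    sumℚ (map (λ As → z ^ℚ Xcap As) (tuples m ks)) * divℚ 1ℚ (ℕtoℚ (length (tuples m ks)))
      ≡⟨ cong₂ (λ x y → x * divℚ 1ℚ y) (pgf-numerator m z ks) (number-of-tuples m ks) ⟩
    Σ≤ m (λ j → ℕtoℚ (choose m j) * (((z - 1ℚ) ^ℚ j) * P j)) * normalizer
      ≡⟨ hypergeometric-series (z - 1ℚ) ⟩
    Σ≤ m (λ j → u j * ((- 1ℚ * (z - 1ℚ)) ^ℚ j)) ∎
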